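{- Let $e$ be a stream element with arrival time step $t_0(e)$, let $t\ge t_0(e)$ be a time step, and let $\alpha\ge1$ be an integer. Then after time step $t$, $\mathbf v(e)=\alpha$ if and only if $$2^{\alpha-1}+(t\bmod 2^{\alpha-1})\le t-t_0(e)<2^{\alpha}+(t\bmod 2^{\alpha}).$$
   Context: Time steps are positive integers $t=1,2,\dots$; each stream element $e$ arrives at some time step $t_0(e)$. The band value $\mathbf v(e)$ of $e$ evolves as follows: at time step $t_0(e)$, $\mathbf v(e)=0$; at each time step $t>t_0(e)$, if $t$ is a multiple of $2^{\mathbf v(e)}$ (with the current value of $\mathbf v(e)$), then $\mathbf v(e)$ is increased by one (otherwise it stays the same). -}

module Defs where

open import Data.Nat using (ℕ; zero; suc; _+_; _^_)
open import Data.Nat.Divisibility using (_∣?_)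
open import Relation.Nullary using (yes; no)

-- bandAfter t₀ d : the band value v(e) of an element e with arrival time
-- step t₀ = t₀(e), right after time step t₀ + d has been processed.
bandAfter : ℕ → ℕ → ℕ
bandAfter t₀ zero = 0
bandAfter t₀ (suc d) with 2 ^ bandAfter t₀ d ∣? (t₀ + suc d)
... | yes _ = suc (bandAfter t₀ d)
... | no  _ = bandAfter t₀ d

-- band value of e (arrival t₀) after time step t (meaningful for t ≥ t₀)
band : ℕ → ℕ → ℕ
band t₀ t = bandAfter t₀ (t Data.Nat.∸ t₀)

open import Data.Nat.DivMod using (_%_)
open import Data.Nat.Properties using (m^n≢0)

_mod2^_ : ℕ → ℕ → ℕ
t mod2^ k = _%_ t (2 ^ k) {{m^n≢0 2 k}}

-- Call [k·2^a, (k+1)·2^a] a block of level a. By induction on t, the band value after step t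
-- exceeds a exactly when a block of level a lies inside [t₀, t]: the value v increases at the
-- next multiple of 2^v, and that multiple ends a block of level v because a block of level
-- v − 1 already ends before it. The last block of level a inside [0, t] ends at
-- t − (t mod 2^a), so the condition reads 2^a + (t mod 2^a) ≤ t − t₀, and the band value
-- is α iff it holds for α − 1 but not for α.
module Submission where

open import Defs
open import Data.Nat using (ℕ; _+_; _∸_; _^_; _≤_; _<_)
open import Data.Product using (_×_)
open import Function.Bundles using (_⇔_)
open import Relation.Binary.PropositionalEquality using (_≡_)

open import Data.Nat using (zero; suc; _*_; _%_; _/_; _≤′_; ≤′-refl; ≤′-step; s≤s; s≤s⁻¹; NonZero; >-nonZero⁻¹)
open import Data.Nat.Properties
open import Data.Nat.DivMod using (m≡m%n+[m/n]*n; m/n*n≤m; m*n/n≡m; /-monoˡ-≤)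
open import Data.Nat.Divisibility using (_∣_; divides; _∣?_)
open import Data.Nat.Tactic.RingSolver using (solve-∀)
open import Data.Product using (_,_)
open import Data.Product.Function.NonDependent.Propositional using (_×-⇔_)
open import Data.Sum using (inj₁; inj₂)
open import Function using (id; _∘_)
open import Function.Bundles using (mk⇔; module Equivalence)
open import Function.Properties.Equivalence using () renaming (trans to ⇔-trans)
open import Function.Related.TypeIsomorphisms using (¬-cong-⇔)
open import Relation.Nullary using (¬_; yes; no; contradiction)
open import Relation.Binary.PropositionalEquality using (refl; sym; trans; subst)

open Equivalence using (to; from)

record BlockWithin (n t₀ t : ℕ) : Set where
  constructor block
  field
    index  : ℕ
    start≥ : t₀ ≤ index * n
    end≤   : suc index * n ≤ t

[1+k]*[2*n]≡[2+k*2]*n : ∀ k n → suc k * (2 * n) ≡ suc (suc (k * 2)) * n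
[1+k]*[2*n]≡[2+k*2]*n = solve-∀

module _ {t₀ : ℕ} where

  BlockWithin-extend : ∀ {n t t′} → t ≤ t′ → BlockWithin n t₀ t → BlockWithin n t₀ t′
  BlockWithin-extend t≤t′ (block k s e) = block k s (≤-trans e t≤t′)

  ¬BlockWithin-empty : ∀ {n} .{{_ : NonZero n}} → ¬ BlockWithin n t₀ t₀
  ¬BlockWithin-empty {n} (block k s e) = <⇒≱ (m<n+m (k * n) (>-nonZero⁻¹ n)) (≤-trans e s)

  BlockWithin-unit : ∀ {t} → t₀ ≤ t → BlockWithin 1 t₀ (suc t)
  BlockWithin-unit {t} t₀≤t =
    block t (subst (t₀ ≤_) (sym (*-identityʳ t)) t₀≤t) (≤-reflexive (*-identityʳ (suc t)))

  BlockWithin-shrink : ∀ {n t} → ¬ n ∣ suc t → BlockWithin n t₀ (suc t) → BlockWithin n t₀ t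
  BlockWithin-shrink n∤1+t (block k s e) with m≤n⇒m<n∨m≡n e
  ... | inj₁ end<1+t = block k s (s≤s⁻¹ end<1+t)
  ... | inj₂ end≡1+t = contradiction (divides (suc k) (sym end≡1+t)) n∤1+t

  BlockWithin-halve : ∀ {n t} → BlockWithin (2 * n) t₀ t → BlockWithin n t₀ t
  BlockWithin-halve {n} {t} (block k s e) =
    block (k * 2) (subst (t₀ ≤_) (sym (*-assoc k 2 n)) s)
      (≤-trans (m≤n+m (suc (k * 2) * n) n) (subst (_≤ t) ([1+k]*[2*n]≡[2+k*2]*n k n) e))

  BlockWithin-halve-pred : ∀ {n t} .{{_ : NonZero n}} →
                           BlockWithin (2 * n) t₀ (suc t) → BlockWithin n t₀ t
  BlockWithin-halve-pred {n} {t} (block k s e) =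
    block (k * 2) (subst (t₀ ≤_) (sym (*-assoc k 2 n)) s)
      (s≤s⁻¹ (≤-trans (m<n+m (suc (k * 2) * n) (>-nonZero⁻¹ n))
                      (subst (_≤ suc t) ([1+k]*[2*n]≡[2+k*2]*n k n) e)))

  -- The witness is the level-2n block ending at t + 1: it starts no earlier than the given
  -- block, because that block ends before t + 1 at a multiple of n.
  BlockWithin-double : ∀ {n t} → BlockWithin n t₀ t → 2 * n ∣ suc t →
                       BlockWithin (2 * n) t₀ (suc t)
  BlockWithin-double (block k s e) (divides zero ())
  BlockWithin-double {n} {t} (block k s e) (divides (suc p) 1+t≡) =
    block p (≤-trans s k*n≤p*[2*n]) (≤-reflexive (sym 1+t≡))
    where
    1+k<2+p*2 : suc k < suc (suc (p * 2))
    1+k<2+p*2 = *-cancelʳ-< n (suc k) (suc (suc (p * 2)))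
      (subst (suc (suc k * n) ≤_) (trans 1+t≡ ([1+k]*[2*n]≡[2+k*2]*n p n)) (s≤s e))

    k*n≤p*[2*n] : k * n ≤ p * (2 * n)
    k*n≤p*[2*n] = subst (k * n ≤_) (*-assoc p 2 n) (*-monoˡ-≤ n (s≤s⁻¹ (s≤s⁻¹ 1+k<2+p*2)))

  BlockWithin-2^-antimono : ∀ {a b t} → a ≤′ b →
                            BlockWithin (2 ^ b) t₀ t → BlockWithin (2 ^ a) t₀ t
  BlockWithin-2^-antimono ≤′-refl          = id
  BlockWithin-2^-antimono (≤′-step a≤′b) = BlockWithin-2^-antimono a≤′b ∘ BlockWithin-halve

BlockWithin⇔≤[t/n]*n : ∀ n .{{_ : NonZero n}} t₀ t → BlockWithin n t₀ t ⇔ t₀ + n ≤ t / n * n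
BlockWithin⇔≤[t/n]*n n t₀ t = mk⇔ last-block (from-multiple (t / n) (m/n*n≤m t n))
  where
  open ≤-Reasoning

  last-block : BlockWithin n t₀ t → t₀ + n ≤ t / n * n
  last-block (block k s e) = begin
    t₀ + n     ≤⟨ +-monoˡ-≤ n s ⟩
    k * n + n  ≡⟨ +-comm (k * n) n ⟩
    suc k * n  ≤⟨ *-monoˡ-≤ n (subst (_≤ t / n) (m*n/n≡m (suc k) n) (/-monoˡ-≤ n e)) ⟩
    t / n * n  ∎

  from-multiple : ∀ q → q * n ≤ t → t₀ + n ≤ q * n → BlockWithin n t₀ t
  from-multiple zero    _ h = contradiction (m+n≤o⇒n≤o t₀ h) (<⇒≱ (>-nonZero⁻¹ n))
  from-multiple (suc p) e h =
    block p (+-cancelʳ-≤ n t₀ (p * n) (subst (t₀ + n ≤_) (+-comm n (p * n)) h)) e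

m+n≤[o/n]*n⇔n+o%n≤o∸m : ∀ m n o .{{_ : NonZero n}} → m ≤ o →
                          m + n ≤ o / n * n ⇔ n + o % n ≤ o ∸ m
m+n≤[o/n]*n⇔n+o%n≤o∸m m n o m≤o = mk⇔
  (λ h → m+n≤o⇒m≤o∸n (n + r) (begin
    n + r + m     ≡⟨ reorder m n r ⟩
    m + n + r     ≤⟨ +-monoˡ-≤ r h ⟩
    o / n * n + r ≡⟨ o≡[o/n]*n+r ⟨
    o             ∎))
  (λ h → +-cancelʳ-≤ r (m + n) (o / n * n) (begin
    m + n + r     ≡⟨ reorder m n r ⟨
    n + r + m     ≤⟨ m≤o∸n⇒m+n≤o (n + r) m≤o h ⟩
    o             ≡⟨ o≡[o/n]*n+r ⟩
    o / n * n + r ∎))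
  where
  open ≤-Reasoning

  r : ℕ
  r = o % n

  reorder : ∀ m n r → n + r + m ≡ m + n + r
  reorder = solve-∀

  o≡[o/n]*n+r : o ≡ o / n * n + r
  o≡[o/n]*n+r = trans (m≡m%n+[m/n]*n o n) (+-comm r (o / n * n))

IsBandAt : ℕ → ℕ → ℕ → Set
IsBandAt t₀ t v = ∀ a → a < v ⇔ BlockWithin (2 ^ a) t₀ t

IsBandAt-block-at-band : ∀ {t₀ t} v → IsBandAt t₀ t v → t₀ ≤ t → 2 ^ v ∣ suc t →
                         BlockWithin (2 ^ v) t₀ (suc t)
IsBandAt-block-at-band zero    _      t₀≤t _        = BlockWithin-unit t₀≤t
IsBandAt-block-at-band (suc w) band-t _    2^v∣1+t = BlockWithin-double (to (band-t w) ≤-refl) 2^v∣1+t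

module _ {t₀ t v : ℕ} (band-t : IsBandAt t₀ t v) where

  IsBandAt-step-∣ : t₀ ≤ t → 2 ^ v ∣ suc t → IsBandAt t₀ (suc t) (suc v)
  IsBandAt-step-∣ t₀≤t 2^v∣1+t a = mk⇔
    (λ a<1+v → BlockWithin-2^-antimono (≤⇒≤′ (s≤s⁻¹ a<1+v)) level-v)
    case-level
    where
    level-v : BlockWithin (2 ^ v) t₀ (suc t)
    level-v = IsBandAt-block-at-band v band-t t₀≤t 2^v∣1+t

    case-level : BlockWithin (2 ^ a) t₀ (suc t) → a < suc v
    case-level b with a ≤? v
    ... | yes a≤v = s≤s a≤v
    ... | no  a≰v = contradiction
      (from (band-t v) (BlockWithin-halve-pred {{m^n≢0 2 v}}
        (BlockWithin-2^-antimono (≤⇒≤′ (≰⇒> a≰v)) b)))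
      (<-irrefl refl)

  IsBandAt-step-∤ : ¬ 2 ^ v ∣ suc t → IsBandAt t₀ (suc t) v
  IsBandAt-step-∤ 2^v∤1+t a = mk⇔
    (BlockWithin-extend (n≤1+n t) ∘ to (band-t a))
    case-level
    where
    case-level : BlockWithin (2 ^ a) t₀ (suc t) → a < v
    case-level b with a <? v
    ... | yes a<v = a<v
    ... | no  a≮v = contradiction
      (from (band-t v) (BlockWithin-shrink 2^v∤1+t (BlockWithin-2^-antimono (≤⇒≤′ (≮⇒≥ a≮v)) b)))
      (<-irrefl refl)

  IsBandAt-≡-suc : ∀ β → v ≡ suc β ⇔ (BlockWithin (2 ^ β) t₀ t × ¬ BlockWithin (2 ^ suc β) t₀ t)
  IsBandAt-≡-suc β = mk⇔
    (λ { refl → to (band-t β) ≤-refl , <-irrefl refl ∘ from (band-t (suc β)) })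
    (λ (b , ¬b′) → ≤-antisym (≮⇒≥ (¬b′ ∘ to (band-t (suc β)))) (from (band-t β) b))

bandAfter-isBandAt : ∀ t₀ d → IsBandAt t₀ (t₀ + d) (bandAfter t₀ d)
bandAfter-isBandAt t₀ zero a =
  mk⇔ (λ ()) (λ b → contradiction (subst (BlockWithin (2 ^ a) t₀) (+-identityʳ t₀) b)
                                  (¬BlockWithin-empty {{m^n≢0 2 a}}))
bandAfter-isBandAt t₀ (suc d) with 2 ^ bandAfter t₀ d ∣? (t₀ + suc d)
... | yes 2^v∣ = subst (λ s → IsBandAt t₀ s (suc v)) (sym (+-suc t₀ d))
  (IsBandAt-step-∣ (bandAfter-isBandAt t₀ d) (m≤m+n t₀ d) (subst (2 ^ v ∣_) (+-suc t₀ d) 2^v∣))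
  where v = bandAfter t₀ d
... | no  2^v∤ = subst (λ s → IsBandAt t₀ s v) (sym (+-suc t₀ d))
  (IsBandAt-step-∤ (bandAfter-isBandAt t₀ d) (2^v∤ ∘ subst (2 ^ v ∣_) (sym (+-suc t₀ d))))
  where v = bandAfter t₀ d

band-isBandAt : ∀ {t₀ t} → t₀ ≤ t → IsBandAt t₀ t (band t₀ t)
band-isBandAt {t₀} {t} t₀≤t =
  subst (λ s → IsBandAt t₀ s (band t₀ t)) (m+[n∸m]≡n t₀≤t) (bandAfter-isBandAt t₀ (t ∸ t₀))

BlockWithin-2^⇔ : ∀ {t₀ t} a → t₀ ≤ t → BlockWithin (2 ^ a) t₀ t ⇔ 2 ^ a + t mod2^ a ≤ t ∸ t₀
BlockWithin-2^⇔ {t₀} {t} a t₀≤t = ⇔-trans (BlockWithin⇔≤[t/n]*n (2 ^ a) {{m^n≢0 2 a}} t₀ t)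
                                            (m+n≤[o/n]*n⇔n+o%n≤o∸m t₀ (2 ^ a) t {{m^n≢0 2 a}} t₀≤t)

lemma2p6 : (t₀ t α : ℕ) → 1 ≤ t₀ → t₀ ≤ t → 1 ≤ α →
    (band t₀ t ≡ α) ⇔
    ((2 ^ (α ∸ 1) + t mod2^ (α ∸ 1) ≤ t ∸ t₀) × (t ∸ t₀ < 2 ^ α + t mod2^ α))
lemma2p6 _  _ zero    _ _    ()
lemma2p6 t₀ t (suc β) _ t₀≤t _ =
  ⇔-trans (IsBandAt-≡-suc (band-isBandAt t₀≤t) β)
          (BlockWithin-2^⇔ β t₀≤t ×-⇔ ⇔-trans (¬-cong-⇔ (BlockWithin-2^⇔ (suc β) t₀≤t)) ≰⇔>)
  where
  ≰⇔> : ∀ {m n} → (¬ m ≤ n) ⇔ n < m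
  ≰⇔> = mk⇔ ≰⇒> <⇒≱
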